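{- Let $r\leq 1$ be an odd integer coprime with $5$, and let $p$ be an odd prime such that $p\equiv 2r\pmod 5$ and $p\geq (5-r)/2$. Then $$ \sum_{k=0}^{(3p-r)/5}(10k+r)\frac{(\frac r5)_k^5}{(1)_k^5}\left(\sum_{j=0}^{k-1}\frac{1}{(r/5+j)^4}-\sum_{j=1}^k\frac1{j^4}\right)\equiv0\pmod{p}. $$
   Context: $(x)_n=x(x+1)\cdots(x+n-1)$ is the Pochhammer symbol; the congruence is in $\mathbb{Z}_p$ (the $p$-adic integers). -}

module Defs where

open import Data.Nat as ℕ using (ℕ; zero; suc)
open import Data.Integer as ℤ using (ℤ; +_; +[1+_]; -[1+_])
open import Data.Integer.Divisibility as ℤD using ()
open import Data.Nat.Divisibility as ℕD using ()
open import Data.Rational as ℚ using (ℚ; mkℚ; 0ℚ; 1ℚ; _+_; _*_; _-_; 1/_; ↥_; ↧ₙ_)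
open import Data.Product using (_×_)
open import Relation.Nullary using (¬_)

nℚ : ℕ → ℚ
nℚ n = (+ n) ℚ./ 1

pow : ℚ → ℕ → ℚ
pow x zero = 1ℚ
pow x (suc k) = pow x k * x

poch : ℚ → ℕ → ℚ
poch x zero = 1ℚ
poch x (suc k) = poch x k * (x + nℚ k)

-- multiplicative inverse, totalised by inv 0 = 0
-- (only ever applied to nonzero arguments in the statement)
inv : ℚ → ℚ
inv q@(mkℚ (+ zero) _ _) = 0ℚ
inv q@(mkℚ +[1+ n ] _ _) = 1/ q
inv q@(mkℚ -[1+ n ] _ _) = 1/ q

sumLt : ℕ → (ℕ → ℚ) → ℚ
sumLt zero f = 0ℚ
sumLt (suc n) f = sumLt n f + f n

sumTo : ℕ → (ℕ → ℚ) → ℚ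
sumTo n f = sumLt (suc n) f

-- q ≡ 0 (mod p) in ℤ_p for a rational q, p prime:
-- q ∈ p ℤ_p, i.e. (q in lowest terms) p ∣ numerator and p ∤ denominator
≡0modp : ℕ → ℚ → Set
≡0modp p q = ((+ p) ℤD.∣ (↥ q)) × ¬ (p ℕD.∣ (↧ₙ q))

module Submission where

-- Put N = (3p − r)/5. The hypotheses make N an even natural number below p, and p ≠ 5.
-- As r + 5N = 3p, modulo p the r of the linear factor 10k + r may be replaced by −5N and
-- a = r/5 by −N; every denominator stays prime to p (it is built from 5, j + 1 and
-- r/5 + j ≡ j − N with j < k ≤ N < p), so the sum is congruent to the same sum at a = −N. There
-- (−N)_k / k! = (−1)^k C(N,k) and Σ_{j<k} (j − N)^(−4) = H(N) − H(N − k), where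
-- H(m) = Σ_{j≤m} j^(−4), so the k-th term becomes
--   (10k − 5N) ((−1)^k C(N,k))^5 (H(N) − H(N − k) − H(k)),
-- which changes sign under k ↦ N − k because N is even.

open import Defs
open import Data.Nat as ℕ using (ℕ; zero; suc; _∸_; s≤s)
open import Data.Nat.Primality using (Prime)
open import Data.Nat.Coprimality using (Coprime)
open import Data.Integer as ℤ using (ℤ; +_; +[1+_]; -[1+_])
open import Data.Integer.Divisibility as ℤD using ()
open import Data.Rational as ℚ using (ℚ; _+_; _*_; _-_; -_; mkℚ; 0ℚ; 1ℚ)
open import Relation.Nullary using (¬_)

open import Data.Empty using (⊥-elim)
open import Data.Product using (Σ; _×_; _,_; ∃-syntax)
open import Data.Sum using (_⊎_; inj₁; inj₂)
open import Relation.Binary.PropositionalEquality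
open import Relation.Nullary.Decidable using (toWitness; toWitnessFalse)
import Data.Nat.Properties as ℕP
import Data.Nat.DivMod as ℕDM
import Data.Nat.Divisibility as ℕD
import Data.Nat.Coprimality as ℕC
open import Data.Nat.Primality using (euclidsLemma; prime⇒nonTrivial; prime⇒irreducible; prime?; prime[2])
import Data.Integer.Properties as ℤP
import Data.Integer.DivMod as ℤDM
import Data.Integer.Divisibility.Signed as S
import Data.Integer.Tactic.RingSolver as ℤRing
open import Data.Rational.Unnormalised as ℚᵘ using (mkℚᵘ; *≡*)
import Data.Rational.Unnormalised.Properties as ℚᵘP
import Data.Rational.Properties as ℚP
open import Data.Rational.Solver using (module +-*-Solver)

open +-*-Solver

ι : ℤ → ℚ
ι i = i ℚ./ 1

fromℚᵘ-homo-+ : ∀ x y → ℚ.fromℚᵘ (x ℚᵘ.+ y) ≡ ℚ.fromℚᵘ x + ℚ.fromℚᵘ y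
fromℚᵘ-homo-+ x y = ℚP.toℚᵘ-injective (ℚᵘP.≃-trans (ℚP.toℚᵘ-fromℚᵘ (x ℚᵘ.+ y))
  (ℚᵘP.≃-sym (ℚᵘP.≃-trans (ℚP.toℚᵘ-homo-+ (ℚ.fromℚᵘ x) (ℚ.fromℚᵘ y))
    (ℚᵘP.+-cong (ℚP.toℚᵘ-fromℚᵘ x) (ℚP.toℚᵘ-fromℚᵘ y)))))

fromℚᵘ-homo-* : ∀ x y → ℚ.fromℚᵘ (x ℚᵘ.* y) ≡ ℚ.fromℚᵘ x * ℚ.fromℚᵘ y
fromℚᵘ-homo-* x y = ℚP.toℚᵘ-injective (ℚᵘP.≃-trans (ℚP.toℚᵘ-fromℚᵘ (x ℚᵘ.* y))
  (ℚᵘP.≃-sym (ℚᵘP.≃-trans (ℚP.toℚᵘ-homo-* (ℚ.fromℚᵘ x) (ℚ.fromℚᵘ y))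
    (ℚᵘP.*-cong (ℚP.toℚᵘ-fromℚᵘ x) (ℚP.toℚᵘ-fromℚᵘ y)))))

ι-homo-+ : ∀ i j → ι (i ℤ.+ j) ≡ ι i + ι j
ι-homo-+ i j = trans (ℚP.fromℚᵘ-cong {mkℚᵘ (i ℤ.+ j) 0} {mkℚᵘ i 0 ℚᵘ.+ mkℚᵘ j 0} (*≡* i+j≡i*1+j*1))
  (fromℚᵘ-homo-+ (mkℚᵘ i 0) (mkℚᵘ j 0))
  where
  i+j≡i*1+j*1 : (i ℤ.+ j) ℤ.* + 1 ≡ (i ℤ.* + 1 ℤ.+ j ℤ.* + 1) ℤ.* + 1
  i+j≡i*1+j*1 = cong (ℤ._* + 1) (cong₂ ℤ._+_ (sym (ℤP.*-identityʳ i)) (sym (ℤP.*-identityʳ j)))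

ι-homo-* : ∀ i j → ι (i ℤ.* j) ≡ ι i * ι j
ι-homo-* i j = fromℚᵘ-homo-* (mkℚᵘ i 0) (mkℚᵘ j 0)

ι-homo-neg : ∀ i → ι (ℤ.- i) ≡ - ι i
ι-homo-neg i = ℚP.toℚᵘ-injective (ℚᵘP.≃-trans (ℚP.toℚᵘ-fromℚᵘ (mkℚᵘ (ℤ.- i) 0))
  (ℚᵘP.≃-sym (ℚᵘP.≃-trans (ℚP.toℚᵘ-homo‿- (ι i)) (ℚᵘP.-‿cong (ℚP.toℚᵘ-fromℚᵘ (mkℚᵘ i 0))))))

ι-injective : ∀ {i j} → ι i ≡ ι j → i ≡ j
ι-injective {i} {j} e with ℚᵘP.≃-trans (ℚᵘP.≃-sym (ℚP.toℚᵘ-fromℚᵘ (mkℚᵘ i 0)))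
                            (ℚᵘP.≃-trans (ℚP.toℚᵘ-cong e) (ℚP.toℚᵘ-fromℚᵘ (mkℚᵘ j 0)))
... | *≡* q = trans (sym (ℤP.*-identityʳ i)) (trans q (ℤP.*-identityʳ j))

nℚ-homo-+ : ∀ m n → nℚ (m ℕ.+ n) ≡ nℚ m + nℚ n
nℚ-homo-+ m n = ι-homo-+ (+ m) (+ n)

nℚ-suc≢0 : ∀ n → nℚ (suc n) ≢ 0ℚ
nℚ-suc≢0 n e with ι-injective {+ suc n} {+ 0} e
... | ()

clears-+ : ∀ {x y n d m e} → x * ι d ≡ ι n → y * ι e ≡ ι m → (x + y) * ι (d ℤ.* e) ≡ ι (n ℤ.* e ℤ.+ m ℤ.* d)
clears-+ {x} {y} {n} {d} {m} {e} xd≡n ye≡m = begin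
    (x + y) * ι (d ℤ.* e)
      ≡⟨ cong ((x + y) *_) (ι-homo-* d e) ⟩
    (x + y) * (ι d * ι e)
      ≡⟨ solve 4 (λ x y d e → (x :+ y) :* (d :* e) := (x :* d) :* e :+ (y :* e) :* d) refl x y (ι d) (ι e) ⟩
    (x * ι d) * ι e + (y * ι e) * ι d
      ≡⟨ cong₂ (λ u v → u * ι e + v * ι d) xd≡n ye≡m ⟩
    ι n * ι e + ι m * ι d
      ≡⟨ cong₂ _+_ (ι-homo-* n e) (ι-homo-* m d) ⟨
    ι (n ℤ.* e) + ι (m ℤ.* d)
      ≡⟨ ι-homo-+ (n ℤ.* e) (m ℤ.* d) ⟨
    ι (n ℤ.* e ℤ.+ m ℤ.* d)            ∎
  where open ≡-Reasoning

clears-* : ∀ {x y n d m e} → x * ι d ≡ ι n → y * ι e ≡ ι m → (x * y) * ι (d ℤ.* e) ≡ ι (n ℤ.* m)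
clears-* {x} {y} {n} {d} {m} {e} xd≡n ye≡m = begin
    (x * y) * ι (d ℤ.* e)
      ≡⟨ cong ((x * y) *_) (ι-homo-* d e) ⟩
    (x * y) * (ι d * ι e)
      ≡⟨ solve 4 (λ x y d e → (x :* y) :* (d :* e) := (x :* d) :* (y :* e)) refl x y (ι d) (ι e) ⟩
    (x * ι d) * (y * ι e)
      ≡⟨ cong₂ _*_ xd≡n ye≡m ⟩
    ι n * ι m
      ≡⟨ ι-homo-* n m ⟨
    ι (n ℤ.* m)              ∎
  where open ≡-Reasoning

clears-neg : ∀ {x n d} → x * ι d ≡ ι n → (- x) * ι d ≡ ι (ℤ.- n)
clears-neg {x} {n} {d} xd≡n = trans (sym (ℚP.neg-distribˡ-* x (ι d))) (trans (cong -_ xd≡n) (sym (ι-homo-neg n)))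

x*inv[x]≡1 : ∀ x → x ≢ 0ℚ → x * inv x ≡ 1ℚ
x*inv[x]≡1 x@(mkℚ (+ zero) _ _) x≢0 = ⊥-elim (x≢0 (ℚP.↥p≡0⇒p≡0 x refl))
x*inv[x]≡1 x@(mkℚ +[1+ _ ] _ _) _ = ℚP.*-inverseʳ x
x*inv[x]≡1 x@(mkℚ -[1+ _ ] _ _) _ = ℚP.*-inverseʳ x

*-≢0 : ∀ {x y} → x ≢ 0ℚ → y ≢ 0ℚ → x * y ≢ 0ℚ
*-≢0 {x} {y} x≢0 y≢0 xy≡0 = x≢0 (begin
    x                ≡⟨ ℚP.*-identityʳ x ⟨
    x * 1ℚ           ≡⟨ cong (x *_) (x*inv[x]≡1 y y≢0) ⟨
    x * (y * inv y)  ≡⟨ ℚP.*-assoc x y (inv y) ⟨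
    (x * y) * inv y  ≡⟨ cong (_* inv y) xy≡0 ⟩
    0ℚ * inv y       ≡⟨ ℚP.*-zeroˡ (inv y) ⟩
    0ℚ               ∎)
  where open ≡-Reasoning

x≡-x⇒x≡0 : ∀ {x} → x ≡ - x → x ≡ 0ℚ
x≡-x⇒x≡0 {x} x≡-x = begin
    x                      ≡⟨ solve 1 (λ x → x := (x :+ x) :* con (+ 1 ℚ./ 2)) refl x ⟩
    (x + x) * (+ 1 ℚ./ 2)  ≡⟨ cong (λ u → (x + u) * (+ 1 ℚ./ 2)) x≡-x ⟩
    (x - x) * (+ 1 ℚ./ 2)  ≡⟨ solve 1 (λ x → (x :- x) :* con (+ 1 ℚ./ 2) := con 0ℚ) refl x ⟩
    0ℚ                     ∎
  where open ≡-Reasoning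

pow-distrib-* : ∀ x y k → pow (x * y) k ≡ pow x k * pow y k
pow-distrib-* x y zero = refl
pow-distrib-* x y (suc k) = begin
    pow (x * y) k * (x * y)
      ≡⟨ cong (_* (x * y)) (pow-distrib-* x y k) ⟩
    (pow x k * pow y k) * (x * y)
      ≡⟨ solve 4 (λ a b x y → (a :* b) :* (x :* y) := (a :* x) :* (b :* y)) refl (pow x k) (pow y k) x y ⟩
    (pow x k * x) * (pow y k * y)  ∎
  where open ≡-Reasoning

pow-+ : ∀ x m n → pow x (m ℕ.+ n) ≡ pow x m * pow x n
pow-+ x zero n = sym (ℚP.*-identityˡ (pow x n))
pow-+ x (suc m) n = begin
    pow x (m ℕ.+ n) * x      ≡⟨ cong (_* x) (pow-+ x m n) ⟩
    (pow x m * pow x n) * x  ≡⟨ solve 3 (λ a b x → (a :* b) :* x := (a :* x) :* b) refl (pow x m) (pow x n) x ⟩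
    (pow x m * x) * pow x n  ∎
  where open ≡-Reasoning

pow-1 : ∀ k → pow 1ℚ k ≡ 1ℚ
pow-1 zero = refl
pow-1 (suc k) = trans (ℚP.*-identityʳ (pow 1ℚ k)) (pow-1 k)

inv-unique : ∀ {x y} → x * y ≡ 1ℚ → inv x ≡ y
inv-unique {x} {y} xy≡1 = begin
    inv x            ≡⟨ ℚP.*-identityʳ (inv x) ⟨
    inv x * 1ℚ       ≡⟨ cong (inv x *_) xy≡1 ⟨
    inv x * (x * y)  ≡⟨ solve 3 (λ i x y → i :* (x :* y) := (x :* i) :* y) refl (inv x) x y ⟩
    (x * inv x) * y  ≡⟨ cong (_* y) (x*inv[x]≡1 x x≢0) ⟩
    1ℚ * y           ≡⟨ ℚP.*-identityˡ y ⟩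
    y                ∎
  where
  open ≡-Reasoning
  x≢0 : x ≢ 0ℚ
  x≢0 refl = ℚP.1≢0 (trans (sym xy≡1) (ℚP.*-zeroˡ y))

inv-pow : ∀ {x} → x ≢ 0ℚ → ∀ k → inv (pow x k) ≡ pow (inv x) k
inv-pow {x} x≢0 k = inv-unique {pow x k} (begin
    pow x k * pow (inv x) k  ≡⟨ pow-distrib-* x (inv x) k ⟨
    pow (x * inv x) k        ≡⟨ cong (λ u → pow u k) (x*inv[x]≡1 x x≢0) ⟩
    pow 1ℚ k                 ≡⟨ pow-1 k ⟩
    1ℚ                       ∎)
  where open ≡-Reasoning

sumLt-cong : ∀ n {f g : ℕ → ℚ} → (∀ j → j ℕ.< n → f j ≡ g j) → sumLt n f ≡ sumLt n g
sumLt-cong zero f≡g = refl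
sumLt-cong (suc n) f≡g = cong₂ _+_ (sumLt-cong n (λ j j<n → f≡g j (ℕP.m<n⇒m<1+n j<n))) (f≡g n ℕP.≤-refl)

sumLt-neg : ∀ n (f : ℕ → ℚ) → sumLt n (λ k → - f k) ≡ - sumLt n f
sumLt-neg zero f = refl
sumLt-neg (suc n) f = trans (cong (_+ - f n) (sumLt-neg n f)) (sym (ℚP.neg-distrib-+ (sumLt n f) (f n)))

sumLt-suc-shift : ∀ n (f : ℕ → ℚ) → sumLt (suc n) f ≡ f 0 + sumLt n (λ k → f (suc k))
sumLt-suc-shift zero f = trans (ℚP.+-identityˡ (f 0)) (sym (ℚP.+-identityʳ (f 0)))
sumLt-suc-shift (suc n) f = trans (cong (_+ f (suc n)) (sumLt-suc-shift n f)) (ℚP.+-assoc (f 0) _ _)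

sumLt-reverse : ∀ n (f : ℕ → ℚ) → sumLt n f ≡ sumLt n (λ k → f (n ∸ suc k))
sumLt-reverse zero f = refl
sumLt-reverse (suc n) f = begin
    sumLt n f + f n                           ≡⟨ ℚP.+-comm (sumLt n f) (f n) ⟩
    f n + sumLt n f                           ≡⟨ cong (f n ℚ.+_) (sumLt-reverse n f) ⟩
    f n + sumLt n (λ k → f (n ∸ suc k))       ≡⟨ sumLt-suc-shift n (λ k → f (n ∸ k)) ⟨
    sumLt (suc n) (λ k → f (suc n ∸ suc k))   ∎
  where open ≡-Reasoning

sumLt-antisymmetric : ∀ n (f : ℕ → ℚ) → (∀ k → k ℕ.< n → f (n ∸ suc k) ≡ - f k) → sumLt n f ≡ 0ℚ
sumLt-antisymmetric n f f-anti = x≡-x⇒x≡0 (begin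
    sumLt n f                          ≡⟨ sumLt-reverse n f ⟩
    sumLt n (λ k → f (n ∸ suc k))      ≡⟨ sumLt-cong n f-anti ⟩
    sumLt n (λ k → - f k)              ≡⟨ sumLt-neg n f ⟩
    - sumLt n f                        ∎)
  where open ≡-Reasoning

sumLt-reflected-prefix : ∀ {N} (g : ℕ → ℚ) k → k ℕ.≤ N →
  sumLt k (λ j → g (N ∸ suc j)) + sumLt (N ∸ k) g ≡ sumLt N g
sumLt-reflected-prefix {N} g zero _ = ℚP.+-identityˡ (sumLt N g)
sumLt-reflected-prefix {N} g (suc k) k<N = begin
    (S + g (N ∸ suc k)) + sumLt (N ∸ suc k) g  ≡⟨ ℚP.+-assoc S _ _ ⟩
    S + (g (N ∸ suc k) + sumLt (N ∸ suc k) g)  ≡⟨ cong (S ℚ.+_) (ℚP.+-comm (g (N ∸ suc k)) _) ⟩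
    S + sumLt (suc (N ∸ suc k)) g              ≡⟨ cong (λ m → S + sumLt m g) (ℕP.+-∸-assoc 1 k<N) ⟨
    S + sumLt (N ∸ k) g                        ≡⟨ sumLt-reflected-prefix g k (ℕP.<⇒≤ k<N) ⟩
    sumLt N g                                  ∎
  where
  open ≡-Reasoning
  S = sumLt k (λ j → g (N ∸ suc j))

_!ℚ : ℕ → ℚ
k !ℚ = poch (nℚ 1) k

!ℚ≢0 : ∀ k → k !ℚ ≢ 0ℚ
!ℚ≢0 zero = ℚP.1≢0
!ℚ≢0 (suc k) = *-≢0 (!ℚ≢0 k) (subst (_≢ 0ℚ) (nℚ-homo-+ 1 k) (nℚ-suc≢0 k))

harmonic₄ : ℕ → ℚ
harmonic₄ m = sumLt m (λ j → inv (pow (nℚ (suc j)) 4))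

-- summand (r ℚ./ 1) (r ℚ./ 5) is the term of the statement; the r of the linear factor is kept
-- apart from a = r/5 because modulo p they are replaced by −5N and −N separately.
summand : ℚ → ℚ → ℕ → ℚ
summand c a k = ((nℚ 10 * nℚ k + c) * (pow (poch a k) 5 * inv (pow (k !ℚ) 5)))
              * (sumLt k (λ j → inv (pow (a + nℚ j) 4)) - harmonic₄ k)

module PAdic (p : ℕ) (p-prime : Prime p) where

  p∣_ : ℤ → Set
  p∣ i = + p S.∣ i

  p∤_ : ℤ → Set
  p∤ i = ¬ p∣ i

  1<p : 1 ℕ.< p
  1<p = ℕ.nonTrivial⇒n>1 p {{prime⇒nonTrivial p-prime}}

  p∣-* : ∀ {i j} → p∣ (i ℤ.* j) → p∣ i ⊎ p∣ j
  p∣-* {i} {j} p∣ij with euclidsLemma ℤ.∣ i ∣ ℤ.∣ j ∣ p-prime (subst (p ℕD.∣_) (ℤP.abs-* i j) (S.∣⇒∣ᵤ p∣ij))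
  ... | inj₁ p∣i = inj₁ (S.∣ᵤ⇒∣ p∣i)
  ... | inj₂ p∣j = inj₂ (S.∣ᵤ⇒∣ p∣j)

  p∤-* : ∀ {i j} → p∤ i → p∤ j → p∤ (i ℤ.* j)
  p∤-* p∤i p∤j p∣ij with p∣-* p∣ij
  ... | inj₁ p∣i = p∤i p∣i
  ... | inj₂ p∣j = p∤j p∣j

  p∣0 : p∣ (+ 0)
  p∣0 = S.∣ᵤ⇒∣ (p ℕD.∣0)

  p∤-nonzero-<p : ∀ {m} → 0 ℕ.< m → m ℕ.< p → p∤ (+ m)
  p∤-nonzero-<p {suc _} _ m<p p∣m = ℕP.<⇒≱ m<p (ℕD.∣⇒≤ (S.∣⇒∣ᵤ p∣m))

  p∤1 : p∤ (+ 1)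
  p∤1 = p∤-nonzero-<p ℕP.0<1+n 1<p

  -- Membership in ℤ₍ₚ₎ is witnessed by any denominator prime to p, not necessarily the reduced one;
  -- this keeps sums and products free of gcd computations.
  record _∈ℤₚ (x : ℚ) : Set where
    constructor fraction
    field
      num den : ℤ
      p∤den : p∤ den
      clears : x * ι den ≡ ι num
  open _∈ℤₚ

  _∈pℤₚ : ℚ → Set
  x ∈pℤₚ = Σ (x ∈ℤₚ) (λ w → p∣ num w)

  _∈ℤₚˣ : ℚ → Set
  x ∈ℤₚˣ = Σ (x ∈ℤₚ) (λ w → p∤ num w)

  ι-∈ℤₚ : ∀ i → ι i ∈ℤₚ
  ι-∈ℤₚ i = fraction i (+ 1) p∤1 (ℚP.*-identityʳ (ι i))

  +-∈ℤₚ : ∀ {x y} → x ∈ℤₚ → y ∈ℤₚ → (x + y) ∈ℤₚ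
  +-∈ℤₚ {x} {y} (fraction n d p∤d xd≡n) (fraction m e p∤e ye≡m) =
    fraction (n ℤ.* e ℤ.+ m ℤ.* d) (d ℤ.* e) (p∤-* p∤d p∤e) (clears-+ {x} {y} {n} {d} {m} {e} xd≡n ye≡m)

  *-∈ℤₚ : ∀ {x y} → x ∈ℤₚ → y ∈ℤₚ → (x * y) ∈ℤₚ
  *-∈ℤₚ {x} {y} (fraction n d p∤d xd≡n) (fraction m e p∤e ye≡m) =
    fraction (n ℤ.* m) (d ℤ.* e) (p∤-* p∤d p∤e) (clears-* {x} {y} {n} {d} {m} {e} xd≡n ye≡m)

  neg-∈ℤₚ : ∀ {x} → x ∈ℤₚ → (- x) ∈ℤₚ
  neg-∈ℤₚ {x} (fraction n d p∤d xd≡n) = fraction (ℤ.- n) d p∤d (clears-neg {x} {n} {d} xd≡n)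

  0∈pℤₚ : 0ℚ ∈pℤₚ
  0∈pℤₚ = ι-∈ℤₚ (+ 0) , p∣0

  +-∈pℤₚ : ∀ {x y} → x ∈pℤₚ → y ∈pℤₚ → (x + y) ∈pℤₚ
  +-∈pℤₚ (v , p∣n) (w , p∣m) = +-∈ℤₚ v w , S.∣m∣n⇒∣m+n (S.∣m⇒∣m*n (den w) p∣n) (S.∣m⇒∣m*n (den v) p∣m)

  *-∈pℤₚ : ∀ {x y} → x ∈pℤₚ → y ∈ℤₚ → (x * y) ∈pℤₚ
  *-∈pℤₚ (v , p∣n) w = *-∈ℤₚ v w , S.∣m⇒∣m*n (num w) p∣n

  neg-∈pℤₚ : ∀ {x} → x ∈pℤₚ → (- x) ∈pℤₚ
  neg-∈pℤₚ (v , p∣n) = neg-∈ℤₚ v , S.∣m⇒∣-m p∣n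

  ∈ℤₚˣ⇒∈ℤₚ : ∀ {x} → x ∈ℤₚˣ → x ∈ℤₚ
  ∈ℤₚˣ⇒∈ℤₚ (w , _) = w

  ι-∈ℤₚˣ : ∀ {i} → p∤ i → ι i ∈ℤₚˣ
  ι-∈ℤₚˣ {i} p∤i = ι-∈ℤₚ i , p∤i

  *-∈ℤₚˣ : ∀ {x y} → x ∈ℤₚˣ → y ∈ℤₚˣ → (x * y) ∈ℤₚˣ
  *-∈ℤₚˣ (v , p∤n) (w , p∤m) = *-∈ℤₚ v w , p∤-* p∤n p∤m

  neg-∈ℤₚˣ : ∀ {x} → x ∈ℤₚˣ → (- x) ∈ℤₚˣ
  neg-∈ℤₚˣ (w , p∤n) = neg-∈ℤₚ w , λ p∣-n → p∤n (subst p∣_ (ℤP.neg-involutive (num w)) (S.∣m⇒∣-m p∣-n))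

  ∈ℤₚˣ⇒≢0 : ∀ {x} → x ∈ℤₚˣ → x ≢ 0ℚ
  ∈ℤₚˣ⇒≢0 (fraction n d _ 0d≡n , p∤n) refl =
    p∤n (subst p∣_ (ι-injective (trans (sym (ℚP.*-zeroˡ (ι d))) 0d≡n)) p∣0)

  inv-∈ℤₚˣ : ∀ {x} → x ∈ℤₚˣ → inv x ∈ℤₚˣ
  inv-∈ℤₚˣ {x} u@(fraction n d p∤d xd≡n , p∤n) = fraction d n p∤n (begin
      inv x * ι n        ≡⟨ cong (inv x *_) xd≡n ⟨
      inv x * (x * ι d)  ≡⟨ solve 3 (λ i x d → i :* (x :* d) := (x :* i) :* d) refl (inv x) x (ι d) ⟩
      (x * inv x) * ι d  ≡⟨ cong (_* ι d) (x*inv[x]≡1 x (∈ℤₚˣ⇒≢0 u)) ⟩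
      1ℚ * ι d           ≡⟨ ℚP.*-identityˡ (ι d) ⟩
      ι d                ∎) , p∤d
    where open ≡-Reasoning

  infix 4 _≡ₚ_
  _≡ₚ_ : ℚ → ℚ → Set
  x ≡ₚ y = x ∈ℤₚ × y ∈ℤₚ × (x - y) ∈pℤₚ

  ≡ₚ-refl : ∀ {x} → x ∈ℤₚ → x ≡ₚ x
  ≡ₚ-refl {x} w = w , w , subst _∈pℤₚ (sym (ℚP.+-inverseʳ x)) 0∈pℤₚ

  ≡ₚ-sym : ∀ {x y} → x ≡ₚ y → y ≡ₚ x
  ≡ₚ-sym {x} {y} (v , w , δ) = w , v , subst _∈pℤₚ (solve 2 (λ x y → :- (x :- y) := y :- x) refl x y) (neg-∈pℤₚ δ)

  +-congₚ : ∀ {x x′ y y′} → x ≡ₚ x′ → y ≡ₚ y′ → x + y ≡ₚ x′ + y′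
  +-congₚ {x} {x′} {y} {y′} (v , v′ , δ) (w , w′ , ε) = +-∈ℤₚ v w , +-∈ℤₚ v′ w′ ,
    subst _∈pℤₚ (solve 4 (λ x x′ y y′ → (x :- x′) :+ (y :- y′) := (x :+ y) :- (x′ :+ y′)) refl x x′ y y′) (+-∈pℤₚ δ ε)

  *-congₚ : ∀ {x x′ y y′} → x ≡ₚ x′ → y ≡ₚ y′ → x * y ≡ₚ x′ * y′
  *-congₚ {x} {x′} {y} {y′} (v , v′ , δ) (w , w′ , ε) = *-∈ℤₚ v w , *-∈ℤₚ v′ w′ ,
    subst _∈pℤₚ (solve 4 (λ x x′ y y′ → (x :- x′) :* y :+ (y :- y′) :* x′ := (x :* y) :- (x′ :* y′)) refl x x′ y y′)
      (+-∈pℤₚ (*-∈pℤₚ δ w) (*-∈pℤₚ ε v′))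

  neg-congₚ : ∀ {x x′} → x ≡ₚ x′ → - x ≡ₚ - x′
  neg-congₚ {x} {x′} (v , v′ , δ) = neg-∈ℤₚ v , neg-∈ℤₚ v′ ,
    subst _∈pℤₚ (solve 2 (λ x x′ → :- (x :- x′) := (:- x) :- (:- x′)) refl x x′) (neg-∈pℤₚ δ)

  ∈ℤₚˣ-resp-≡ₚ : ∀ {x y} → x ≡ₚ y → y ∈ℤₚˣ → x ∈ℤₚˣ
  ∈ℤₚˣ-resp-≡ₚ {x} {y} (_ , _ , (v , p∣n)) (w , p∤m) =
    fraction (num s) (den s) (p∤den s) (subst (λ z → z * ι (den s) ≡ ι (num s)) x-y+y≡x (clears s)) , p∤sum
    where
    s = +-∈ℤₚ v w
    x-y+y≡x : (x - y) + y ≡ x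
    x-y+y≡x = solve 2 (λ x y → (x :- y) :+ y := x) refl x y
    p∤sum : p∤ (num v ℤ.* den w ℤ.+ num w ℤ.* den v)
    p∤sum p∣sum = p∤-* p∤m (p∤den v) (S.∣m+n∣m⇒∣n p∣sum (S.∣m⇒∣m*n (den w) p∣n))

  inv-congₚ : ∀ {x x′} → x ≡ₚ x′ → x′ ∈ℤₚˣ → inv x ≡ₚ inv x′
  inv-congₚ {x} {x′} x≡x′@(_ , _ , δ) u′ = ∈ℤₚˣ⇒∈ℤₚ i , ∈ℤₚˣ⇒∈ℤₚ i′ ,
      subst _∈pℤₚ difference (*-∈pℤₚ (neg-∈pℤₚ δ) (*-∈ℤₚ (∈ℤₚˣ⇒∈ℤₚ i) (∈ℤₚˣ⇒∈ℤₚ i′)))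
    where
    u = ∈ℤₚˣ-resp-≡ₚ x≡x′ u′
    i = inv-∈ℤₚˣ u
    i′ = inv-∈ℤₚˣ u′
    difference : (- (x - x′)) * (inv x * inv x′) ≡ inv x - inv x′
    difference = begin
        (- (x - x′)) * (inv x * inv x′)
          ≡⟨ solve 4 (λ x x′ i i′ → (:- (x :- x′)) :* (i :* i′) := i :* (x′ :* i′) :- (x :* i) :* i′) refl x x′ (inv x) (inv x′) ⟩
        inv x * (x′ * inv x′) - (x * inv x) * inv x′
          ≡⟨ cong₂ (λ a b → inv x * a - b * inv x′) (x*inv[x]≡1 x′ (∈ℤₚˣ⇒≢0 u′)) (x*inv[x]≡1 x (∈ℤₚˣ⇒≢0 u)) ⟩
        inv x * 1ℚ - 1ℚ * inv x′
          ≡⟨ cong₂ _-_ (ℚP.*-identityʳ (inv x)) (ℚP.*-identityˡ (inv x′)) ⟩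
        inv x - inv x′                           ∎
      where open ≡-Reasoning

  pow-congₚ : ∀ {x x′} → x ≡ₚ x′ → ∀ k → pow x k ≡ₚ pow x′ k
  pow-congₚ x≡x′ zero = ≡ₚ-refl (ι-∈ℤₚ (+ 1))
  pow-congₚ x≡x′ (suc k) = *-congₚ (pow-congₚ x≡x′ k) x≡x′

  poch-congₚ : ∀ {x x′} → x ≡ₚ x′ → ∀ k → poch x k ≡ₚ poch x′ k
  poch-congₚ x≡x′ zero = ≡ₚ-refl (ι-∈ℤₚ (+ 1))
  poch-congₚ x≡x′ (suc k) = *-congₚ (poch-congₚ x≡x′ k) (+-congₚ x≡x′ (≡ₚ-refl (ι-∈ℤₚ (+ k))))

  sumLt-congₚ : ∀ n {f g : ℕ → ℚ} → (∀ j → j ℕ.< n → f j ≡ₚ g j) → sumLt n f ≡ₚ sumLt n g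
  sumLt-congₚ zero f≡g = ≡ₚ-refl (ι-∈ℤₚ (+ 0))
  sumLt-congₚ (suc n) f≡g = +-congₚ (sumLt-congₚ n (λ j j<n → f≡g j (ℕP.m<n⇒m<1+n j<n))) (f≡g n ℕP.≤-refl)

  sumLt-∈ℤₚ : ∀ n {f : ℕ → ℚ} → (∀ j → j ℕ.< n → f j ∈ℤₚ) → sumLt n f ∈ℤₚ
  sumLt-∈ℤₚ zero _ = ι-∈ℤₚ (+ 0)
  sumLt-∈ℤₚ (suc n) f∈ℤₚ = +-∈ℤₚ (sumLt-∈ℤₚ n (λ j j<n → f∈ℤₚ j (ℕP.m<n⇒m<1+n j<n))) (f∈ℤₚ n ℕP.≤-refl)

  ≡ₚ0⇒∈pℤₚ : ∀ {x} → x ≡ₚ 0ℚ → x ∈pℤₚ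
  ≡ₚ0⇒∈pℤₚ {x} (_ , _ , δ) = subst _∈pℤₚ (ℚP.+-identityʳ x) δ

  pow-∈ℤₚˣ : ∀ {x} → x ∈ℤₚˣ → ∀ k → pow x k ∈ℤₚˣ
  pow-∈ℤₚˣ u zero = ι-∈ℤₚˣ p∤1
  pow-∈ℤₚˣ u (suc k) = *-∈ℤₚˣ (pow-∈ℤₚˣ u k) u

  factorial-∈ℤₚˣ : ∀ {k} → k ℕ.< p → k !ℚ ∈ℤₚˣ
  factorial-∈ℤₚˣ {zero} _ = ι-∈ℤₚˣ p∤1
  factorial-∈ℤₚˣ {suc k} k<p = *-∈ℤₚˣ (factorial-∈ℤₚˣ (ℕP.<-trans (ℕP.n<1+n k) k<p))
    (subst _∈ℤₚˣ (nℚ-homo-+ 1 k) (ι-∈ℤₚˣ (p∤-nonzero-<p ℕP.0<1+n k<p)))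

  ∈pℤₚ⇒≡0modp : ∀ {x} → x ∈pℤₚ → ≡0modp p x
  ∈pℤₚ⇒≡0modp {x@(mkℚ a b-1 a⊥b)} (fraction n d p∤d xd≡n , p∣n) =
    S.∣⇒∣ᵤ p∣a , λ p∣b → ℕP.<-irrefl (sym (ℕC.recompute a⊥b (S.∣⇒∣ᵤ p∣a , p∣b))) 1<p
    where
    ad≡n[b] : (a ℤ.* d) ℤ.* + 1 ≡ n ℤ.* (+ suc b-1 ℤ.* + 1)
    ad≡n[b] with ℚᵘP.≃-trans (ℚᵘP.≃-sym (ℚᵘP.*-congˡ {mkℚᵘ a b-1} (ℚP.toℚᵘ-fromℚᵘ (mkℚᵘ d 0))))
                   (ℚᵘP.≃-trans (ℚᵘP.≃-sym (ℚP.toℚᵘ-homo-* x (ι d)))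
                     (ℚᵘP.≃-trans (ℚP.toℚᵘ-cong xd≡n) (ℚP.toℚᵘ-fromℚᵘ (mkℚᵘ n 0))))
    ... | *≡* eq = eq
    p∣ad : p∣ (a ℤ.* d)
    p∣ad = subst p∣_ (trans (sym ad≡n[b]) (ℤP.*-identityʳ (a ℤ.* d))) (S.∣m⇒∣m*n (+ suc b-1 ℤ.* + 1) p∣n)
    p∣a : p∣ a
    p∣a with p∣-* p∣ad
    ... | inj₁ p∣a = p∣a
    ... | inj₂ p∣d = ⊥-elim (p∤d p∣d)

sign : ℕ → ℚ
sign k = pow (- 1ℚ) k

sign-square : ∀ k → sign k * sign k ≡ 1ℚ
sign-square k = trans (sym (pow-distrib-* (- 1ℚ) (- 1ℚ) k)) (pow-1 k)

sign-even : ∀ {N} → 2 ℕD.∣ N → sign N ≡ 1ℚ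
sign-even {N} (ℕD.divides h N≡h*2) = begin
    sign N                     ≡⟨ cong sign (trans N≡h*2 (ℕP.*-comm h 2)) ⟩
    sign (h ℕ.+ (h ℕ.+ 0))     ≡⟨ cong (λ m → sign (h ℕ.+ m)) (ℕP.+-identityʳ h) ⟩
    sign (h ℕ.+ h)             ≡⟨ pow-+ (- 1ℚ) h h ⟩
    sign h * sign h            ≡⟨ sign-square h ⟩
    1ℚ                         ∎
  where open ≡-Reasoning

module Reflection (N : ℕ) where

  -N+j≡-[N∸j] : ∀ {j} → j ℕ.≤ N → - nℚ N + nℚ j ≡ - nℚ (N ∸ j)
  -N+j≡-[N∸j] {j} j≤N = begin
      - nℚ N + nℚ j                    ≡⟨ cong (λ m → - nℚ m + nℚ j) (ℕP.m∸n+n≡m j≤N) ⟨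
      - nℚ (N ∸ j ℕ.+ j) + nℚ j        ≡⟨ cong (λ u → - u + nℚ j) (nℚ-homo-+ (N ∸ j) j) ⟩
      - (nℚ (N ∸ j) + nℚ j) + nℚ j     ≡⟨ solve 2 (λ a b → :- (a :+ b) :+ b := :- a) refl (nℚ (N ∸ j)) (nℚ j) ⟩
      - nℚ (N ∸ j)                     ∎
    where open ≡-Reasoning

  poch[-N]*[N∸k]!≡sign*N! : ∀ k → k ℕ.≤ N → poch (- nℚ N) k * (N ∸ k) !ℚ ≡ sign k * N !ℚ
  poch[-N]*[N∸k]!≡sign*N! zero _ = refl
  poch[-N]*[N∸k]!≡sign*N! (suc k) k<N = begin
      (poch (- nℚ N) k * (- nℚ N + nℚ k)) * m !ℚ
        ≡⟨ cong (λ u → poch (- nℚ N) k * u * m !ℚ) (-N+j≡-[N∸j] (ℕP.<⇒≤ k<N)) ⟩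
      (poch (- nℚ N) k * (- nℚ (N ∸ k))) * m !ℚ
        ≡⟨ cong (λ u → poch (- nℚ N) k * (- u) * m !ℚ) (trans (cong nℚ N∸k≡1+m) (nℚ-homo-+ 1 m)) ⟩
      (poch (- nℚ N) k * (- (nℚ 1 + nℚ m))) * m !ℚ
        ≡⟨ solve 3 (λ a c f → a :* (:- c) :* f := (a :* (f :* c)) :* (:- con 1ℚ)) refl (poch (- nℚ N) k) (nℚ 1 + nℚ m) (m !ℚ) ⟩
      (poch (- nℚ N) k * suc m !ℚ) * (- 1ℚ)
        ≡⟨ cong (λ n → poch (- nℚ N) k * n !ℚ * (- 1ℚ)) N∸k≡1+m ⟨
      (poch (- nℚ N) k * (N ∸ k) !ℚ) * (- 1ℚ)
        ≡⟨ cong (_* (- 1ℚ)) (poch[-N]*[N∸k]!≡sign*N! k (ℕP.<⇒≤ k<N)) ⟩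
      (sign k * N !ℚ) * (- 1ℚ)
        ≡⟨ solve 3 (λ s f m → (s :* f) :* m := (s :* m) :* f) refl (sign k) (N !ℚ) (- 1ℚ) ⟩
      sign (suc k) * N !ℚ                                 ∎
    where
    open ≡-Reasoning
    m = N ∸ suc k
    N∸k≡1+m : N ∸ k ≡ suc m
    N∸k≡1+m = ℕP.+-∸-assoc 1 k<N

  binomial : ℕ → ℚ
  binomial k = N !ℚ * inv ((N ∸ k) !ℚ) * inv (k !ℚ)

  binomial-reflect : ∀ {k} → k ℕ.≤ N → binomial (N ∸ k) ≡ binomial k
  binomial-reflect {k} k≤N = begin
      N !ℚ * inv ((N ∸ (N ∸ k)) !ℚ) * inv ((N ∸ k) !ℚ)
        ≡⟨ cong (λ m → N !ℚ * inv (m !ℚ) * inv ((N ∸ k) !ℚ)) (ℕP.m∸[m∸n]≡n k≤N) ⟩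
      N !ℚ * inv (k !ℚ) * inv ((N ∸ k) !ℚ)
        ≡⟨ solve 3 (λ a b c → a :* b :* c := a :* c :* b) refl (N !ℚ) (inv (k !ℚ)) (inv ((N ∸ k) !ℚ)) ⟩
      N !ℚ * inv ((N ∸ k) !ℚ) * inv (k !ℚ)              ∎
    where open ≡-Reasoning

  poch[-N]/k!≡sign*binomial : ∀ {k} → k ℕ.≤ N → poch (- nℚ N) k * inv (k !ℚ) ≡ sign k * binomial k
  poch[-N]/k!≡sign*binomial {k} k≤N = begin
      P * inv (k !ℚ)
        ≡⟨ cong (_* inv (k !ℚ)) (ℚP.*-identityʳ P) ⟨
      P * 1ℚ * inv (k !ℚ)
        ≡⟨ cong (λ u → P * u * inv (k !ℚ)) (x*inv[x]≡1 ((N ∸ k) !ℚ) (!ℚ≢0 (N ∸ k))) ⟨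
      P * ((N ∸ k) !ℚ * inv ((N ∸ k) !ℚ)) * inv (k !ℚ)
        ≡⟨ solve 4 (λ a b c d → a :* (b :* c) :* d := (a :* b) :* c :* d) refl P ((N ∸ k) !ℚ) (inv ((N ∸ k) !ℚ)) (inv (k !ℚ)) ⟩
      (P * (N ∸ k) !ℚ) * inv ((N ∸ k) !ℚ) * inv (k !ℚ)
        ≡⟨ cong (λ u → u * inv ((N ∸ k) !ℚ) * inv (k !ℚ)) (poch[-N]*[N∸k]!≡sign*N! k k≤N) ⟩
      (sign k * N !ℚ) * inv ((N ∸ k) !ℚ) * inv (k !ℚ)
        ≡⟨ solve 4 (λ a b c d → (a :* b) :* c :* d := a :* (b :* c :* d)) refl (sign k) (N !ℚ) (inv ((N ∸ k) !ℚ)) (inv (k !ℚ)) ⟩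
      sign k * binomial k                                ∎
    where
    open ≡-Reasoning
    P = poch (- nℚ N) k

  weight : ℕ → ℚ
  weight k = pow (poch (- nℚ N) k) 5 * inv (pow (k !ℚ) 5)

  weight≡signed-binomial⁵ : ∀ {k} → k ℕ.≤ N → weight k ≡ pow (sign k * binomial k) 5
  weight≡signed-binomial⁵ {k} k≤N = begin
      pow (poch (- nℚ N) k) 5 * inv (pow (k !ℚ) 5)       ≡⟨ cong (pow (poch (- nℚ N) k) 5 *_) (inv-pow (!ℚ≢0 k) 5) ⟩
      pow (poch (- nℚ N) k) 5 * pow (inv (k !ℚ)) 5       ≡⟨ pow-distrib-* (poch (- nℚ N) k) (inv (k !ℚ)) 5 ⟨
      pow (poch (- nℚ N) k * inv (k !ℚ)) 5               ≡⟨ cong (λ u → pow u 5) (poch[-N]/k!≡sign*binomial k≤N) ⟩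
      pow (sign k * binomial k) 5                        ∎
    where open ≡-Reasoning

  linear : ℕ → ℚ
  linear k = nℚ 10 * nℚ k + - (nℚ 5 * nℚ N)

  linear-reflect : ∀ {k} → k ℕ.≤ N → linear (N ∸ k) ≡ - linear k
  linear-reflect {k} k≤N = begin
      nℚ 10 * m + - (nℚ 5 * nℚ N)        ≡⟨ cong (λ u → nℚ 10 * m + - (nℚ 5 * u)) N≡m+k ⟩
      nℚ 10 * m + - (nℚ 5 * (m + n))     ≡⟨ solve 2 (λ m n → c10 :* m :+ :- (c5 :* (m :+ n)) := :- (c10 :* n :+ :- (c5 :* (m :+ n)))) refl m n ⟩
      - (nℚ 10 * n + - (nℚ 5 * (m + n))) ≡⟨ cong (λ u → - (nℚ 10 * n + - (nℚ 5 * u))) N≡m+k ⟨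
      - (nℚ 10 * n + - (nℚ 5 * nℚ N))    ∎
    where
    open ≡-Reasoning
    m = nℚ (N ∸ k)
    n = nℚ k
    c10 = con (nℚ 10)
    c5 = con (nℚ 5)
    N≡m+k : nℚ N ≡ m + n
    N≡m+k = trans (cong nℚ (sym (ℕP.m∸n+n≡m k≤N))) (nℚ-homo-+ (N ∸ k) k)

  harmonic-gap : ℕ → ℚ
  harmonic-gap k = sumLt k (λ j → inv (pow (- nℚ N + nℚ j) 4)) - harmonic₄ k

  harmonic-gap≡H[N]-H[N∸k]-H[k] : ∀ {k} → k ℕ.≤ N → harmonic-gap k ≡ harmonic₄ N - harmonic₄ (N ∸ k) - harmonic₄ k
  harmonic-gap≡H[N]-H[N∸k]-H[k] {k} k≤N = cong (_- harmonic₄ k) (begin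
      sumLt k (λ j → inv (pow (- nℚ N + nℚ j) 4))  ≡⟨ sumLt-cong k (λ j j<k → term≡ (ℕP.<-≤-trans j<k k≤N)) ⟩
      S                                            ≡⟨ solve 2 (λ s h → s := (s :+ h) :- h) refl S (harmonic₄ (N ∸ k)) ⟩
      (S + harmonic₄ (N ∸ k)) - harmonic₄ (N ∸ k)  ≡⟨ cong (_- harmonic₄ (N ∸ k)) (sumLt-reflected-prefix g k k≤N) ⟩
      harmonic₄ N - harmonic₄ (N ∸ k)              ∎)
    where
    open ≡-Reasoning
    g : ℕ → ℚ
    g j = inv (pow (nℚ (suc j)) 4)
    S = sumLt k (λ j → g (N ∸ suc j))
    term≡ : ∀ {j} → j ℕ.< N → inv (pow (- nℚ N + nℚ j) 4) ≡ g (N ∸ suc j)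
    term≡ {j} j<N = cong inv (begin
        pow (- nℚ N + nℚ j) 4
          ≡⟨ cong (λ u → pow u 4) (-N+j≡-[N∸j] (ℕP.<⇒≤ j<N)) ⟩
        pow (- nℚ (N ∸ j)) 4
          ≡⟨ cong (λ m → pow (- nℚ m) 4) (ℕP.+-∸-assoc 1 j<N) ⟩
        pow (- nℚ (suc (N ∸ suc j))) 4
          ≡⟨ solve 1 (λ x → con 1ℚ :* (:- x) :* (:- x) :* (:- x) :* (:- x) := con 1ℚ :* x :* x :* x :* x) refl (nℚ (suc (N ∸ suc j))) ⟩
        pow (nℚ (suc (N ∸ suc j))) 4      ∎)

  harmonic-gap-reflect : ∀ {k} → k ℕ.≤ N → harmonic-gap (N ∸ k) ≡ harmonic-gap k
  harmonic-gap-reflect {k} k≤N = begin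
      harmonic-gap (N ∸ k)
        ≡⟨ harmonic-gap≡H[N]-H[N∸k]-H[k] (ℕP.m∸n≤m N k) ⟩
      harmonic₄ N - harmonic₄ (N ∸ (N ∸ k)) - harmonic₄ (N ∸ k)
        ≡⟨ cong (λ m → harmonic₄ N - harmonic₄ m - harmonic₄ (N ∸ k)) (ℕP.m∸[m∸n]≡n k≤N) ⟩
      harmonic₄ N - harmonic₄ k - harmonic₄ (N ∸ k)
        ≡⟨ solve 3 (λ a b c → a :- b :- c := a :- c :- b) refl (harmonic₄ N) (harmonic₄ k) (harmonic₄ (N ∸ k)) ⟩
      harmonic₄ N - harmonic₄ (N ∸ k) - harmonic₄ k
        ≡⟨ harmonic-gap≡H[N]-H[N∸k]-H[k] k≤N ⟨
      harmonic-gap k                                         ∎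
    where open ≡-Reasoning

  module _ (N-even : 2 ℕD.∣ N) where

    sign-reflect : ∀ {k} → k ℕ.≤ N → sign (N ∸ k) ≡ sign k
    sign-reflect {k} k≤N = begin
        sign (N ∸ k)                      ≡⟨ ℚP.*-identityʳ (sign (N ∸ k)) ⟨
        sign (N ∸ k) * 1ℚ                 ≡⟨ cong (sign (N ∸ k) *_) (sign-square k) ⟨
        sign (N ∸ k) * (sign k * sign k)  ≡⟨ ℚP.*-assoc (sign (N ∸ k)) (sign k) (sign k) ⟨
        sign (N ∸ k) * sign k * sign k    ≡⟨ cong (_* sign k) (pow-+ (- 1ℚ) (N ∸ k) k) ⟨
        sign (N ∸ k ℕ.+ k) * sign k       ≡⟨ cong (λ m → sign m * sign k) (ℕP.m∸n+n≡m k≤N) ⟩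
        sign N * sign k                   ≡⟨ cong (_* sign k) (sign-even N-even) ⟩
        1ℚ * sign k                       ≡⟨ ℚP.*-identityˡ (sign k) ⟩
        sign k                            ∎
      where open ≡-Reasoning

    weight-reflect : ∀ {k} → k ℕ.≤ N → weight (N ∸ k) ≡ weight k
    weight-reflect {k} k≤N = begin
        weight (N ∸ k)
          ≡⟨ weight≡signed-binomial⁵ (ℕP.m∸n≤m N k) ⟩
        pow (sign (N ∸ k) * binomial (N ∸ k)) 5
          ≡⟨ cong₂ (λ s b → pow (s * b) 5) (sign-reflect k≤N) (binomial-reflect k≤N) ⟩
        pow (sign k * binomial k) 5
          ≡⟨ weight≡signed-binomial⁵ k≤N ⟨
        weight k                                      ∎
      where open ≡-Reasoning

    summand-reflect : ∀ {k} → k ℕ.≤ N →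
      summand (- (nℚ 5 * nℚ N)) (- nℚ N) (N ∸ k) ≡ - summand (- (nℚ 5 * nℚ N)) (- nℚ N) k
    summand-reflect {k} k≤N = begin
        (linear (N ∸ k) * weight (N ∸ k)) * harmonic-gap (N ∸ k)
          ≡⟨ cong₂ (λ l w → (l * w) * harmonic-gap (N ∸ k)) (linear-reflect k≤N) (weight-reflect k≤N) ⟩
        (- linear k * weight k) * harmonic-gap (N ∸ k)
          ≡⟨ cong ((- linear k * weight k) *_) (harmonic-gap-reflect k≤N) ⟩
        (- linear k * weight k) * harmonic-gap k
          ≡⟨ solve 3 (λ l w h → (:- l :* w) :* h := :- ((l :* w) :* h)) refl (linear k) (weight k) (harmonic-gap k) ⟩
        - ((linear k * weight k) * harmonic-gap k)      ∎
      where open ≡-Reasoning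

    summand-sum-vanishes : sumTo N (summand (- (nℚ 5 * nℚ N)) (- nℚ N)) ≡ 0ℚ
    summand-sum-vanishes = sumLt-antisymmetric (suc N) _ (λ k k<1+N → summand-reflect (ℕP.≤-pred k<1+N))

module Congruence (p : ℕ) (p-prime : Prime p) where
  open PAdic p p-prime

  summand-congₚ : ∀ {c c′ a a′ k} → k ℕ.< p → c ≡ₚ c′ → a ≡ₚ a′ →
    (∀ j → j ℕ.< k → (a′ + nℚ j) ∈ℤₚˣ) → summand c a k ≡ₚ summand c′ a′ k
  summand-congₚ {c} {c′} {a} {a′} {k} k<p c≡c′ a≡a′ a′+j-unit =
    *-congₚ (*-congₚ linear≡ₚ weight≡ₚ) (+-congₚ shifted≡ₚ (neg-congₚ (≡ₚ-refl harmonic∈ℤₚ)))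
    where
    inv-unit-∈ℤₚ : ∀ {x} → x ∈ℤₚˣ → inv x ∈ℤₚ
    inv-unit-∈ℤₚ u = ∈ℤₚˣ⇒∈ℤₚ (inv-∈ℤₚˣ u)

    linear≡ₚ : nℚ 10 * nℚ k + c ≡ₚ nℚ 10 * nℚ k + c′
    linear≡ₚ = +-congₚ (≡ₚ-refl (*-∈ℤₚ (ι-∈ℤₚ (+ 10)) (ι-∈ℤₚ (+ k)))) c≡c′

    weight≡ₚ : pow (poch a k) 5 * inv (pow (k !ℚ) 5) ≡ₚ pow (poch a′ k) 5 * inv (pow (k !ℚ) 5)
    weight≡ₚ = *-congₚ (pow-congₚ (poch-congₚ a≡a′ k) 5) (≡ₚ-refl (inv-unit-∈ℤₚ (pow-∈ℤₚˣ (factorial-∈ℤₚˣ k<p) 5)))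

    shifted≡ₚ : sumLt k (λ j → inv (pow (a + nℚ j) 4)) ≡ₚ sumLt k (λ j → inv (pow (a′ + nℚ j) 4))
    shifted≡ₚ = sumLt-congₚ k (λ j j<k →
      inv-congₚ (pow-congₚ (+-congₚ a≡a′ (≡ₚ-refl (ι-∈ℤₚ (+ j)))) 4) (pow-∈ℤₚˣ (a′+j-unit j j<k) 4))

    harmonic∈ℤₚ : harmonic₄ k ∈ℤₚ
    harmonic∈ℤₚ = sumLt-∈ℤₚ k (λ j j<k →
      inv-unit-∈ℤₚ (pow-∈ℤₚˣ (ι-∈ℤₚˣ (p∤-nonzero-<p ℕP.0<1+n (ℕP.≤-<-trans j<k k<p))) 4))

  module _ (r : ℤ) (N : ℕ) (p∣r+5N : p∣ (r ℤ.+ + 5 ℤ.* + N)) where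

    r+5N≡ : ι r + nℚ 5 * nℚ N ≡ ι (r ℤ.+ + 5 ℤ.* + N)
    r+5N≡ = trans (cong (ι r ℚ.+_) (sym (ι-homo-* (+ 5) (+ N)))) (sym (ι-homo-+ r (+ 5 ℤ.* + N)))

    r≡ₚ-5N : ι r ≡ₚ - (nℚ 5 * nℚ N)
    r≡ₚ-5N = ι-∈ℤₚ r , neg-∈ℤₚ (*-∈ℤₚ (ι-∈ℤₚ (+ 5)) (ι-∈ℤₚ (+ N))) ,
      (fraction _ (+ 1) p∤1 (begin
          (ι r - - (nℚ 5 * nℚ N)) * 1ℚ
            ≡⟨ solve 2 (λ r m → (r :- (:- m)) :* con 1ℚ := r :+ m) refl (ι r) (nℚ 5 * nℚ N) ⟩
          ι r + nℚ 5 * nℚ N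
            ≡⟨ r+5N≡ ⟩
          ι (r ℤ.+ + 5 ℤ.* + N)         ∎) , p∣r+5N)
      where open ≡-Reasoning

    r/5≡ₚ-N : p∤ (+ 5) → r ℚ./ 5 ≡ₚ - nℚ N
    r/5≡ₚ-N p∤5 = fraction r (+ 5) p∤5 r/5*5≡r , neg-∈ℤₚ (ι-∈ℤₚ (+ N)) ,
      (fraction _ (+ 5) p∤5 (begin
          (r ℚ./ 5 - - nℚ N) * ι (+ 5)
            ≡⟨ solve 3 (λ a n f → (a :- (:- n)) :* f := a :* f :+ f :* n) refl (r ℚ./ 5) (nℚ N) (ι (+ 5)) ⟩
          r ℚ./ 5 * ι (+ 5) + nℚ 5 * nℚ N
            ≡⟨ cong (_+ nℚ 5 * nℚ N) r/5*5≡r ⟩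
          ι r + nℚ 5 * nℚ N
            ≡⟨ r+5N≡ ⟩
          ι (r ℤ.+ + 5 ℤ.* + N)              ∎) , p∣r+5N)
      where
      open ≡-Reasoning
      r/5*5≡r : r ℚ./ 5 * ι (+ 5) ≡ ι r
      r/5*5≡r = trans (sym (fromℚᵘ-homo-* (mkℚᵘ r 4) (mkℚᵘ (+ 5) 0)))
        (ℚP.fromℚᵘ-cong {mkℚᵘ r 4 ℚᵘ.* mkℚᵘ (+ 5) 0} {mkℚᵘ r 0} (*≡* (ℤP.*-identityʳ (r ℤ.* + 5))))

    sum-∈pℤₚ : N ℕ.< p → p∤ (+ 5) → 2 ℕD.∣ N → sumTo N (summand (ι r) (r ℚ./ 5)) ∈pℤₚ
    sum-∈pℤₚ N<p p∤5 N-even = ≡ₚ0⇒∈pℤₚ (subst (S ≡ₚ_) (Reflection.summand-sum-vanishes N N-even) S≡ₚS′)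
      where
      S = sumTo N (summand (ι r) (r ℚ./ 5))
      -N+j-unit : ∀ {j} → j ℕ.< N → (- nℚ N + nℚ j) ∈ℤₚˣ
      -N+j-unit {j} j<N = subst _∈ℤₚˣ (sym (Reflection.-N+j≡-[N∸j] N (ℕP.<⇒≤ j<N)))
        (neg-∈ℤₚˣ (ι-∈ℤₚˣ (p∤-nonzero-<p (ℕP.m<n⇒0<n∸m j<N) (ℕP.≤-<-trans (ℕP.m∸n≤m N j) N<p))))
      S≡ₚS′ : S ≡ₚ sumTo N (summand (- (nℚ 5 * nℚ N)) (- nℚ N))
      S≡ₚS′ = sumLt-congₚ (suc N) (λ k k<1+N →
        summand-congₚ (ℕP.≤-<-trans (ℕP.≤-pred k<1+N) N<p) r≡ₚ-5N (r/5≡ₚ-N p∤5)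
          (λ j j<k → -N+j-unit (ℕP.<-≤-trans j<k (ℕP.≤-pred k<1+N))))

odd⇒1+2q : ∀ {i} → ¬ ((+ 2) ℤD.∣ i) → ∃[ q ] i ≡ + 1 ℤ.+ q ℤ.* + 2
odd⇒1+2q {i} i-odd with i ℤ.%ℕ 2 | ℤDM.n%ℕd<d i 2 | ℤDM.a≡a%ℕn+[a/ℕn]*n i 2
... | 0 | _ | i≡0+q*2 = ⊥-elim (i-odd (S.∣⇒∣ᵤ (S.divides (i ℤ./ℕ 2) (trans i≡0+q*2 (ℤP.+-identityˡ _)))))
... | 1 | _ | i≡1+q*2 = i ℤ./ℕ 2 , i≡1+q*2
... | suc (suc _) | s≤s (s≤s ()) | _

module _ (r : ℤ) (p N : ℕ) (3p-r≡N*5 : + 3 ℤ.* + p ℤ.- r ≡ + N ℤ.* + 5) where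

  2∣N*5 : ¬ ((+ 2) ℤD.∣ (+ p)) → ¬ ((+ 2) ℤD.∣ r) → 2 ℕD.∣ N ℕ.* 5
  2∣N*5 p-odd r-odd with odd⇒1+2q {+ p} p-odd | odd⇒1+2q {r} r-odd
  ... | q , p≡1+2q | s , r≡1+2s =
    subst (2 ℕD.∣_) (ℤP.abs-* (+ N) (+ 5)) (S.∣⇒∣ᵤ (S.divides (+ 1 ℤ.+ + 3 ℤ.* q ℤ.- s) (begin
        + N ℤ.* + 5                                          ≡⟨ 3p-r≡N*5 ⟨
        + 3 ℤ.* + p ℤ.- r                                    ≡⟨ cong₂ (λ a b → + 3 ℤ.* a ℤ.- b) p≡1+2q r≡1+2s ⟩
        + 3 ℤ.* (+ 1 ℤ.+ q ℤ.* + 2) ℤ.- (+ 1 ℤ.+ s ℤ.* + 2)  ≡⟨ regroup q s ⟩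
        (+ 1 ℤ.+ + 3 ℤ.* q ℤ.- s) ℤ.* + 2                    ∎)))
    where
    open ≡-Reasoning
    regroup : ∀ q s → + 3 ℤ.* (+ 1 ℤ.+ q ℤ.* + 2) ℤ.- (+ 1 ℤ.+ s ℤ.* + 2) ≡ (+ 1 ℤ.+ + 3 ℤ.* q ℤ.- s) ℤ.* + 2
    regroup = ℤRing.solve-∀

  N-even : ¬ ((+ 2) ℤD.∣ (+ p)) → ¬ ((+ 2) ℤD.∣ r) → 2 ℕD.∣ N
  N-even p-odd r-odd with euclidsLemma N 5 prime[2] (2∣N*5 p-odd r-odd)
  ... | inj₁ 2∣N = 2∣N
  ... | inj₂ 2∣5 = ⊥-elim (toWitnessFalse {a? = 2 ℕD.∣? 5} _ 2∣5)

  N<p : (+ 5) ℤ.- r ℤ.≤ (+ 2) ℤ.* (+ p) → N ℕ.< p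
  N<p 5-r≤2p = ℕP.*-cancelʳ-≤ (suc N) p 5
    (ℤP.drop‿+≤+ (subst₂ ℤ._≤_ 3p+[5-r]≡[1+N]*5 3p+2p≡p*5 (ℤP.+-monoʳ-≤ (+ 3 ℤ.* + p) 5-r≤2p)))
    where
    open ≡-Reasoning
    regroup : ∀ a r → a ℤ.+ (+ 5 ℤ.- r) ≡ + 5 ℤ.+ (a ℤ.- r)
    regroup = ℤRing.solve-∀
    3p+[5-r]≡[1+N]*5 : + 3 ℤ.* + p ℤ.+ (+ 5 ℤ.- r) ≡ + (suc N ℕ.* 5)
    3p+[5-r]≡[1+N]*5 = begin
        + 3 ℤ.* + p ℤ.+ (+ 5 ℤ.- r)   ≡⟨ regroup (+ 3 ℤ.* + p) r ⟩
        + 5 ℤ.+ (+ 3 ℤ.* + p ℤ.- r)   ≡⟨ cong (λ z → + 5 ℤ.+ z) 3p-r≡N*5 ⟩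
        + 5 ℤ.+ + N ℤ.* + 5           ≡⟨ cong (λ z → + 5 ℤ.+ z) (ℤP.pos-* N 5) ⟨
        + 5 ℤ.+ + (N ℕ.* 5)           ≡⟨ ℤP.pos-+ 5 (N ℕ.* 5) ⟨
        + (suc N ℕ.* 5)               ∎
    3p+2p≡p*5 : + 3 ℤ.* + p ℤ.+ + 2 ℤ.* + p ≡ + (p ℕ.* 5)
    3p+2p≡p*5 = trans (3a+2a≡a*5 (+ p)) (sym (ℤP.pos-* p 5))
      where
      3a+2a≡a*5 : ∀ a → + 3 ℤ.* a ℤ.+ + 2 ℤ.* a ≡ a ℤ.* + 5
      3a+2a≡a*5 = ℤRing.solve-∀

  p∣r+5N : + p S.∣ (r ℤ.+ + 5 ℤ.* + N)
  p∣r+5N = subst (+ p S.∣_) 3p≡r+5N (S.∣n⇒∣m*n (+ 3) S.∣-refl)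
    where
    open ≡-Reasoning
    a≡r+[a-r] : ∀ a r → a ≡ r ℤ.+ (a ℤ.- r)
    a≡r+[a-r] = ℤRing.solve-∀
    3p≡r+5N : + 3 ℤ.* + p ≡ r ℤ.+ + 5 ℤ.* + N
    3p≡r+5N = begin
        + 3 ℤ.* + p                   ≡⟨ a≡r+[a-r] (+ 3 ℤ.* + p) r ⟩
        r ℤ.+ (+ 3 ℤ.* + p ℤ.- r)     ≡⟨ cong (λ z → r ℤ.+ z) 3p-r≡N*5 ⟩
        r ℤ.+ + N ℤ.* + 5             ≡⟨ cong (λ z → r ℤ.+ z) (ℤP.*-comm (+ N) (+ 5)) ⟩
        r ℤ.+ + 5 ℤ.* + N             ∎

  upper-limit≡N : ℤ.∣ + 3 ℤ.* + p ℤ.- r ∣ ℕ./ 5 ≡ N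
  upper-limit≡N = begin
      ℤ.∣ + 3 ℤ.* + p ℤ.- r ∣ ℕ./ 5   ≡⟨ cong (λ z → ℤ.∣ z ∣ ℕ./ 5) 3p-r≡N*5 ⟩
      ℤ.∣ + N ℤ.* + 5 ∣ ℕ./ 5         ≡⟨ cong (ℕ._/ 5) (ℤP.abs-* (+ N) (+ 5)) ⟩
      N ℕ.* 5 ℕ./ 5                   ≡⟨ ℕDM.m*n/n≡m N 5 ⟩
      N                               ∎
    where open ≡-Reasoning

3p-r≡ℕ*5 : ∀ {r p} → r ℤ.≤ + 1 → 0 ℕ.< p → (+ 5) ℤD.∣ ((+ p) ℤ.- (+ 2) ℤ.* r) →
  ∃[ N ] + 3 ℤ.* + p ℤ.- r ≡ + N ℤ.* + 5
3p-r≡ℕ*5 {r} {p} r≤1 0<p 5∣p-2r with S.∣ᵤ⇒∣ {+ 5} {+ p ℤ.- + 2 ℤ.* r} 5∣p-2r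
... | S.divides t p-2r≡t*5 = natural (+ 3 ℤ.* t ℤ.+ r) 0≤M*5 3p-r≡M*5
  where
  open ≡-Reasoning
  expand : ∀ a r → + 3 ℤ.* a ℤ.- r ≡ + 3 ℤ.* (a ℤ.- + 2 ℤ.* r) ℤ.+ + 5 ℤ.* r
  expand = ℤRing.solve-∀
  collect : ∀ t r → + 3 ℤ.* (t ℤ.* + 5) ℤ.+ + 5 ℤ.* r ≡ (+ 3 ℤ.* t ℤ.+ r) ℤ.* + 5
  collect = ℤRing.solve-∀
  3p-r≡M*5 : + 3 ℤ.* + p ℤ.- r ≡ (+ 3 ℤ.* t ℤ.+ r) ℤ.* + 5
  3p-r≡M*5 = begin
      + 3 ℤ.* + p ℤ.- r                          ≡⟨ expand (+ p) r ⟩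
      + 3 ℤ.* (+ p ℤ.- + 2 ℤ.* r) ℤ.+ + 5 ℤ.* r  ≡⟨ cong (λ z → + 3 ℤ.* z ℤ.+ + 5 ℤ.* r) p-2r≡t*5 ⟩
      + 3 ℤ.* (t ℤ.* + 5) ℤ.+ + 5 ℤ.* r          ≡⟨ collect t r ⟩
      (+ 3 ℤ.* t ℤ.+ r) ℤ.* + 5                  ∎
  1≤3p : + 1 ℤ.≤ + 3 ℤ.* + p
  1≤3p = subst (+ 1 ℤ.≤_) (ℤP.pos-* 3 p) (ℤ.+≤+ (ℕP.≤-trans 0<p (ℕP.m≤m+n p (2 ℕ.* p))))
  0≤M*5 : + 0 ℤ.≤ (+ 3 ℤ.* t ℤ.+ r) ℤ.* + 5
  0≤M*5 = subst (+ 0 ℤ.≤_) 3p-r≡M*5 (ℤP.i≤j⇒0≤j-i (ℤP.≤-trans r≤1 1≤3p))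
  natural : ∀ M → + 0 ℤ.≤ M ℤ.* + 5 → + 3 ℤ.* + p ℤ.- r ≡ M ℤ.* + 5 → ∃[ N ] + 3 ℤ.* + p ℤ.- r ≡ + N ℤ.* + 5
  natural (+ N) _ eq = N , eq
  natural -[1+ _ ] () _

p∤5 : ∀ {r p} → Prime p → Coprime ℤ.∣ r ∣ 5 → (+ 5) ℤD.∣ ((+ p) ℤ.- (+ 2) ℤ.* r) → ¬ (+ p S.∣ + 5)
p∤5 {r} {p} p-prime r⊥5 5∣p-2r p∣5 = 5≢1 (r⊥5 (5∣r , ℕD.∣-refl))
  where
  5≢1 : 5 ≢ 1
  5≢1 ()
  prime[5] : Prime 5
  prime[5] = toWitness {a? = prime? 5} _
  p≡5 : p ≡ 5
  p≡5 with prime⇒irreducible prime[5] (S.∣⇒∣ᵤ p∣5)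
  ... | inj₁ p≡1 = ⊥-elim (ℕP.<-irrefl (sym p≡1) (PAdic.1<p p p-prime))
  ... | inj₂ p≡5 = p≡5
  5∣2r : + 5 S.∣ (+ 2 ℤ.* r)
  5∣2r = subst (+ 5 S.∣_) (5-[5-2r]≡2r r)
    (S.∣m∣n⇒∣m-n S.∣-refl (subst (λ q → + 5 S.∣ (+ q ℤ.- + 2 ℤ.* r)) p≡5 (S.∣ᵤ⇒∣ 5∣p-2r)))
    where
    5-[5-2r]≡2r : ∀ r → + 5 ℤ.- (+ 5 ℤ.- + 2 ℤ.* r) ≡ + 2 ℤ.* r
    5-[5-2r]≡2r = ℤRing.solve-∀
  5∣r : 5 ℕD.∣ ℤ.∣ r ∣
  5∣r with euclidsLemma 2 ℤ.∣ r ∣ prime[5] (subst (5 ℕD.∣_) (ℤP.abs-* (+ 2) r) (S.∣⇒∣ᵤ 5∣2r))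
  ... | inj₁ 5∣2 = ⊥-elim (toWitnessFalse {a? = 5 ℕD.∣? 2} _ 5∣2)
  ... | inj₂ 5∣r = 5∣r

lemma3p2 : (r : ℤ) → r ℤ.≤ + 1 → ¬ ((+ 2) ℤD.∣ r) → Coprime ℤ.∣ r ∣ 5
    → (p : ℕ) → Prime p → ¬ ((+ 2) ℤD.∣ (+ p))
    → (+ 5) ℤD.∣ ((+ p) ℤ.- (+ 2) ℤ.* r)
    → (+ 5) ℤ.- r ℤ.≤ (+ 2) ℤ.* (+ p)
    → ≡0modp p
        (sumTo (ℤ.∣ (+ 3) ℤ.* (+ p) ℤ.- r ∣ ℕ./ 5) (λ k →
          (((nℚ 10) * (nℚ k) + (r ℚ./ 1))
            * (pow (poch (r ℚ./ 5) k) 5 * inv (pow (poch (nℚ 1) k) 5)))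
          * (sumLt k (λ j → inv (pow ((r ℚ./ 5) + nℚ j) 4))
             - sumLt k (λ j → inv (pow (nℚ (ℕ.suc j)) 4)))))
lemma3p2 r r≤1 r-odd r⊥5 p p-prime p-odd 5∣p-2r 5-r≤2p
  with N , 3p-r≡N*5 ← 3p-r≡ℕ*5 r≤1 (ℕP.<⇒≤ (PAdic.1<p p p-prime)) 5∣p-2r
  rewrite upper-limit≡N r p N 3p-r≡N*5 =
    PAdic.∈pℤₚ⇒≡0modp p p-prime
      (Congruence.sum-∈pℤₚ p p-prime r N (p∣r+5N r p N 3p-r≡N*5)
        (N<p r p N 3p-r≡N*5 5-r≤2p) (p∤5 {r} p-prime r⊥5 5∣p-2r) (N-even r p N 3p-r≡N*5 p-odd r-odd))
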